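{- Let $D\ge 3$ and let $\mathrm{Aut}(X)$ be the automorphism group of $\square_{2D+1}$ and $\mathrm{Aut}_{\mathbf 0}(X)$ the stabilizer of $\mathbf 0=\{\emptyset,S\}$. Then the sets $X_{i,j,t}=\{(x,y,z)\in X^3:\partial(x,y,z)=(i,j,t)\}$, $(i,j,t)\in\mathcal I'$, are the orbits of $X\times X\times X$ under $\mathrm{Aut}(X)$, and the sets $X^{\mathbf 0}_{i,j,t}=\{(x,y)\in X\times X:\partial(\mathbf 0,x,y)=(i,j,t)\}$, $(i,j,t)\in\mathcal I'$, are the orbits of $X\times X$ under $\mathrm{Aut}_{\mathbf 0}(X)$.
   Context: Let $S=\{1,\dots,2D+1\}$, $X$ the set of unordered pairs $\{u,u'\}$ of subsets of $S$ with $u\cap u'=\emptyset$, $u\cup u'=S$. The folded cube $\square_{2D+1}$ is the graph on $X$ with distance $\partial(x,y)=\min\{|x_1\triangle y_1|,|x_1\triangle y_2|\}$ for $x=\{x_1,x_2\},y=\{y_1,y_2\}$ (adjacent iff distance $1$). For $x,y,z\in X$ define $\partial(x,y,z)=(i,j,t)$: $i=\partial(x,y)$, $j=\partial(x,z)$; label parts $x=(x_1,x_2)$, $y=(y_1,y_2)$, $z=(z_1,z_2)$ so that $|x_1\triangle y_1|=i$, $|x_1\triangle z_1|=j$; and $t=|(x_1\triangle y_1)\cap(x_1\triangle z_1)|$. (Equivalently, $\partial(\mathbf 0,x,y)=(|x_1|,|y_1|,|x_1\cap y_1|)$ when $x_1,y_1$ denote the smaller parts.) Let $\mathcal I'=\{(i,j,t):0\le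 t\le i,j\le D,\ i+j-t\le 2D\}$. -}

module Defs where

open import Data.Bool using (Bool; _xor_; if_then_else_)
open import Data.Nat using (ℕ; _+_; _≤_; _≤ᵇ_)
open import Data.Nat.Properties using ()
open import Data.Product using (_×_; _,_; Σ; ∃)
open import Data.Sum using (_⊎_)
open import Data.Vec using (zipWith)
open import Data.Fin.Subset using (Subset; ∁; _∩_; ∣_∣; ⊥)
open import Relation.Binary.PropositionalEquality using (_≡_)
open import Function.Bundles using (_⇔_)

-- A vertex {u, S∖u} of the folded cube on S = Fin n is represented by
-- either of its parts u : Subset n; two representatives denote the same
-- vertex iff they are equal or complementary.
X : ℕ → Set
X n = Subset n

_≈_ : ∀ {n} → X n → X n → Set
x ≈ y = (x ≡ y) ⊎ (x ≡ ∁ y)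

_△_ : ∀ {n} → Subset n → Subset n → Subset n
u △ v = zipWith _xor_ u v

dist : ∀ {n} → X n → X n → ℕ
dist x y = if ∣ x △ y ∣ ≤ᵇ ∣ x △ ∁ y ∣ then ∣ x △ y ∣ else ∣ x △ ∁ y ∣

Adj : ∀ {n} → X n → X n → Set
Adj x y = dist x y ≡ 1

-- the part y₁ of y labelled so that |x₁ △ y₁| = ∂(x,y)   (x₁ = x)
label : ∀ {n} → X n → X n → Subset n
label x y = if ∣ x △ y ∣ ≤ᵇ ∣ x △ ∁ y ∣ then y else ∁ y

∂₃ : ∀ {n} → X n → X n → X n → ℕ × ℕ × ℕ
∂₃ x y z = dist x y , dist x z , ∣ (x △ label x y) ∩ (x △ label x z) ∣

𝟎 : ∀ {n} → X n
𝟎 = ⊥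

record Aut (n : ℕ) : Set where
  field
    to       : X n → X n
    from     : X n → X n
    to-cong  : ∀ {x y} → x ≈ y → to x ≈ to y
    from-cong : ∀ {x y} → x ≈ y → from x ≈ from y
    to-from  : ∀ x → to (from x) ≈ x
    from-to  : ∀ x → from (to x) ≈ x
    adj      : ∀ x y → Adj x y ⇔ Adj (to x) (to y)
open Aut public

InI' : ℕ → ℕ × ℕ × ℕ → Set
InI' D (i , j , t) = t ≤ i × t ≤ j × i ≤ D × j ≤ D × i + j ≤ (D + D) + t

SameOrbit₃ : ∀ {n} → X n → X n → X n → X n → X n → X n → Set
SameOrbit₃ {n} x y z x' y' z' =
  Σ (Aut n) λ σ → to σ x ≈ x' × to σ y ≈ y' × to σ z ≈ z'

SameOrbit₀ : ∀ {n} → X n → X n → X n → X n → Set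
SameOrbit₀ {n} x y x' y' =
  Σ (Aut n) λ σ → to σ 𝟎 ≈ 𝟎 × to σ x ≈ x' × to σ y ≈ y'

module Submission where

-- A vertex is represented by either of its parts u ⊆ S = Fin n (x ≈ y: same vertex), and
-- the distance is the weight of the difference set: dist x y = wt (x △ y), where
-- wt w = min (|w|, |S ∖ w|).
-- * Invariance. dist is the path metric of the graph (geodesic-step), so automorphisms
--   are isometries (aut-preserves-dist). In odd dimension the parity of |w| tells w from
--   its complement, so ∂(x,y,z) is a function of the three pairwise distances
--   (∂₃-from-distances); hence ∂ is constant on orbits.
-- * Transitivity. The shifts u ↦ π(u △ a) △ b, with π a permutation of coordinates, are
--   automorphisms (shift-aut). If ∂(x,y,z) = ∂(x',y',z'), the difference sets (δ x y, δ x z)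
--   and (δ x' y', δ x' z') have equal sizes and intersection sizes, so a coordinate
--   permutation carries one pair onto the other (pair-transport, from the general fact that
--   vectors with equal multiplicities are rearrangements of each other); the shift with
--   a = x, b = x' then maps (x,y,z) to (x',y',z').
-- * Range. Distances are at most D, so ∂ takes values in I′ (∂₃∈I′), and every
--   (i,j,t) ∈ I′ equals ∂(0,y,z) for two intervals y, z (realise-from-𝟎).
-- The stabiliser statement is the case x = x' = 0, since the shift used then fixes 0.

open import Defs
open import Data.Nat using (ℕ; zero; suc; _+_; _≤_; _≤ᵇ_; _⊓_; _∸_; z≤n; s≤s)
open import Data.Nat.Properties
open import Data.Nat.Solver using (module +-*-Solver)
open import Data.Product using (_×_; _,_; ∃; proj₁; proj₂)
open import Data.Product.Properties using (≡-dec)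
open import Data.Sum using (inj₁; inj₂)
open import Data.Empty using (⊥-elim)
open import Data.Bool using (Bool; true; false; not; _xor_; if_then_else_; T)
import Data.Bool.Properties as Bool
open import Data.Bool.Properties
  using (not-involutive; not-distribˡ-xor; not-distribʳ-xor; xor-assoc; xor-comm; xor-same; xor-identityˡ; xor-identityʳ)
open import Data.Fin using (Fin; zero; suc)
open import Data.Fin.Permutation using (Permutation′; _⟨$⟩ʳ_; inverseʳ; transpose; lift₀; _∘ₚ_; flip)
import Data.Fin.Permutation as Perm
open import Data.Vec using (Vec; []; _∷_; lookup; tabulate; zip; zipWith; map; count; tail)
open import Data.Vec.Properties
  using (zipWith-assoc; zipWith-comm; zipWith-identityˡ; zipWith-identityʳ; lookup∘tabulate; tabulate∘lookup;
         tabulate-cong; lookup-zipWith; lookup-map; map-proj₁-zip; map-proj₂-zip)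
open import Data.Fin.Subset using (Subset; ∁; _∩_; ∣_∣; ⊥)
open import Data.Fin.Subset.Properties using (∣p∣≤n; ∣∁p∣≡n∸∣p∣; ∣⊥∣≡0; ∣p∩q∣≤∣p∣; ∣p∩q∣≤∣q∣; ∩-zeroˡ)
open import Algebra.Properties.CommutativeMonoid.Sum +-0-commutativeMonoid using (sum; sum-permute; sum-cong-≗)
open import Level using (0ℓ)
open import Function using (_∘′_)
open import Function.Bundles using (_⇔_; mk⇔; Equivalence)
open import Relation.Nullary using (does; yes; no)
open import Relation.Nullary.Decidable using (dec-true)
open import Relation.Unary using (Pred; Decidable)
open import Relation.Binary.Definitions using (DecidableEquality; tri<; tri≈; tri>)
open import Relation.Binary.PropositionalEquality

private variable
  A B C : Set
  n : ℕ

△-comm : (u v : Subset n) → u △ v ≡ v △ u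
△-comm = zipWith-comm xor-comm

△-assoc : (u v w : Subset n) → (u △ v) △ w ≡ u △ (v △ w)
△-assoc = zipWith-assoc xor-assoc

△-identityˡ : (u : Subset n) → ⊥ △ u ≡ u
△-identityˡ = zipWith-identityˡ xor-identityˡ

△-identityʳ : (u : Subset n) → u △ ⊥ ≡ u
△-identityʳ = zipWith-identityʳ xor-identityʳ

△-self : (u : Subset n) → u △ u ≡ ⊥
△-self []      = refl
△-self (a ∷ u) = cong₂ _∷_ (xor-same a) (△-self u)

∁-involutive : (u : Subset n) → ∁ (∁ u) ≡ u
∁-involutive []      = refl
∁-involutive (a ∷ u) = cong₂ _∷_ (not-involutive a) (∁-involutive u)

∁-△ˡ : (u v : Subset n) → ∁ u △ v ≡ ∁ (u △ v)
∁-△ˡ []      []      = refl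
∁-△ˡ (a ∷ u) (b ∷ v) = cong₂ _∷_ (sym (not-distribˡ-xor a b)) (∁-△ˡ u v)

∁-△ʳ : (u v : Subset n) → u △ ∁ v ≡ ∁ (u △ v)
∁-△ʳ []      []      = refl
∁-△ʳ (a ∷ u) (b ∷ v) = cong₂ _∷_ (sym (not-distribʳ-xor a b)) (∁-△ʳ u v)

△-cancelˡ : (w u : Subset n) → w △ (w △ u) ≡ u
△-cancelˡ w u = begin
  w △ (w △ u) ≡⟨ △-assoc w w u ⟨
  (w △ w) △ u ≡⟨ cong (_△ u) (△-self w) ⟩
  ⊥ △ u       ≡⟨ △-identityˡ u ⟩
  u           ∎
  where open ≡-Reasoning

△-cancelʳ : (u w : Subset n) → (u △ w) △ w ≡ u
△-cancelʳ u w = begin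
  (u △ w) △ w ≡⟨ △-assoc u w w ⟩
  u △ (w △ w) ≡⟨ cong (u △_) (△-self w) ⟩
  u △ ⊥       ≡⟨ △-identityʳ u ⟩
  u           ∎
  where open ≡-Reasoning

△-translate : (w u v : Subset n) → (w △ u) △ (w △ v) ≡ u △ v
△-translate w u v = begin
  (w △ u) △ (w △ v) ≡⟨ cong (_△ (w △ v)) (△-comm w u) ⟩
  (u △ w) △ (w △ v) ≡⟨ △-assoc u w (w △ v) ⟩
  u △ (w △ (w △ v)) ≡⟨ cong (u △_) (△-cancelˡ w v) ⟩
  u △ v             ∎
  where open ≡-Reasoning

∣p∣+∣∁p∣≡n : (u : Subset n) → ∣ u ∣ + ∣ ∁ u ∣ ≡ n
∣p∣+∣∁p∣≡n u = trans (cong (∣ u ∣ +_) (∣∁p∣≡n∸∣p∣ u)) (m+[n∸m]≡n (∣p∣≤n u))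

∣p△q∣+2∣p∩q∣ : (u v : Subset n) → ∣ u △ v ∣ + (∣ u ∩ v ∣ + ∣ u ∩ v ∣) ≡ ∣ u ∣ + ∣ v ∣
∣p△q∣+2∣p∩q∣ []          []          = refl
∣p△q∣+2∣p∩q∣ (true ∷ u)  (true ∷ v)  = begin
  ∣ u △ v ∣ + (suc ∣ u ∩ v ∣ + suc ∣ u ∩ v ∣)     ≡⟨ cong (∣ u △ v ∣ +_) (cong suc (+-suc ∣ u ∩ v ∣ _)) ⟩
  ∣ u △ v ∣ + suc (suc (∣ u ∩ v ∣ + ∣ u ∩ v ∣))   ≡⟨ +-suc ∣ u △ v ∣ _ ⟩
  suc (∣ u △ v ∣ + suc (∣ u ∩ v ∣ + ∣ u ∩ v ∣))   ≡⟨ cong suc (+-suc ∣ u △ v ∣ _) ⟩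
  suc (suc (∣ u △ v ∣ + (∣ u ∩ v ∣ + ∣ u ∩ v ∣))) ≡⟨ cong (suc ∘′ suc) (∣p△q∣+2∣p∩q∣ u v) ⟩
  suc (suc (∣ u ∣ + ∣ v ∣))                       ≡⟨ cong suc (+-suc ∣ u ∣ ∣ v ∣) ⟨
  suc (∣ u ∣ + suc ∣ v ∣)                         ∎
  where open ≡-Reasoning
∣p△q∣+2∣p∩q∣ (true ∷ u)  (false ∷ v) = cong suc (∣p△q∣+2∣p∩q∣ u v)
∣p△q∣+2∣p∩q∣ (false ∷ u) (true ∷ v)  = trans (cong suc (∣p△q∣+2∣p∩q∣ u v)) (sym (+-suc ∣ u ∣ ∣ v ∣))
∣p△q∣+2∣p∩q∣ (false ∷ u) (false ∷ v) = ∣p△q∣+2∣p∩q∣ u v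

∣p∣≡0⇒p≡⊥ : (u : Subset n) → ∣ u ∣ ≡ 0 → u ≡ ⊥
∣p∣≡0⇒p≡⊥ []          _ = refl
∣p∣≡0⇒p≡⊥ (false ∷ u) e = cong (false ∷_) (∣p∣≡0⇒p≡⊥ u e)

≈-sym : {x y : X n} → x ≈ y → y ≈ x
≈-sym (inj₁ refl)         = inj₁ refl
≈-sym {y = y} (inj₂ refl) = inj₂ (sym (∁-involutive y))

≈-trans : {x y z : X n} → x ≈ y → y ≈ z → x ≈ z
≈-trans (inj₁ refl) q           = q
≈-trans (inj₂ refl) (inj₁ refl) = inj₂ refl
≈-trans (inj₂ refl) (inj₂ refl) = inj₁ (∁-involutive _)

∁-natural⇒≈-resp : (f : Subset n → Subset n) → (∀ u → f (∁ u) ≡ ∁ (f u)) →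
                   {u v : Subset n} → u ≈ v → f u ≈ f v
∁-natural⇒≈-resp f f-∁ (inj₁ refl)         = inj₁ refl
∁-natural⇒≈-resp f f-∁ {v = v} (inj₂ refl) = inj₂ (f-∁ v)

△-resp-≈ : {u u' v v' : Subset n} → u ≈ u' → v ≈ v' → (u △ v) ≈ (u' △ v')
△-resp-≈ {u = u} {u'} {v} {v'} p q =
  ≈-trans (∁-natural⇒≈-resp (_△ v) (λ w → ∁-△ˡ w v) p)
          (∁-natural⇒≈-resp (u' △_) (∁-△ʳ u') q)

wt : Subset n → ℕ
wt w = ∣ w ∣ ⊓ ∣ ∁ w ∣

if-≤ᵇ≡⊓ : ∀ a b → (if a ≤ᵇ b then a else b) ≡ a ⊓ b
if-≤ᵇ≡⊓ a b with a ≤ᵇ b in eq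
... | true  = sym (m≤n⇒m⊓n≡m (≤ᵇ⇒≤ a b (subst T (sym eq) _)))
... | false = sym (m≥n⇒m⊓n≡n (≰⇒≥ λ a≤b → subst T eq (≤⇒≤ᵇ a≤b)))

dist≡wt : (x y : X n) → dist x y ≡ wt (x △ y)
dist≡wt x y = trans (if-≤ᵇ≡⊓ ∣ x △ y ∣ ∣ x △ ∁ y ∣) (cong (λ w → ∣ x △ y ∣ ⊓ ∣ w ∣) (∁-△ʳ x y))

wt-∁ : (w : Subset n) → wt (∁ w) ≡ wt w
wt-∁ w = trans (cong (∣ ∁ w ∣ ⊓_) (cong ∣_∣ (∁-involutive w))) (⊓-comm ∣ ∁ w ∣ ∣ w ∣)

wt-resp-≈ : {w w' : Subset n} → w ≈ w' → wt w ≡ wt w'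
wt-resp-≈ (inj₁ refl)          = refl
wt-resp-≈ {w' = w'} (inj₂ refl) = wt-∁ w'

dist-resp-≈ : {x x' y y' : X n} → x ≈ x' → y ≈ y' → dist x y ≡ dist x' y'
dist-resp-≈ {x = x} {x'} {y} {y'} p q = begin
  dist x y     ≡⟨ dist≡wt x y ⟩
  wt (x △ y)   ≡⟨ wt-resp-≈ (△-resp-≈ p q) ⟩
  wt (x' △ y') ≡⟨ dist≡wt x' y' ⟨
  dist x' y'   ∎
  where open ≡-Reasoning

wt-representative : (w : Subset n) → ∃ λ w' → w ≈ w' × wt w ≡ ∣ w' ∣
wt-representative w with ⊓-sel ∣ w ∣ ∣ ∁ w ∣
... | inj₁ e = w , inj₁ refl , e
... | inj₂ e = ∁ w , inj₂ (sym (∁-involutive w)) , e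

wt-small : (w : Subset n) → ∣ w ∣ + ∣ w ∣ ≤ n → wt w ≡ ∣ w ∣
wt-small w h = m≤n⇒m⊓n≡m (+-cancelˡ-≤ ∣ w ∣ _ _ (subst (∣ w ∣ + ∣ w ∣ ≤_) (sym (∣p∣+∣∁p∣≡n w)) h))

wt≡0 : (w : Subset n) → wt w ≡ 0 → w ≈ ⊥
wt≡0 w e with wt-representative w
... | w' , w≈w' , wtw = ≈-trans w≈w' (inj₁ (∣p∣≡0⇒p≡⊥ w' (trans (sym wtw) e)))

dist≡0⇒≈ : (x y : X n) → dist x y ≡ 0 → x ≈ y
dist≡0⇒≈ x y e = ≈-sym (subst₂ _≈_ (△-cancelˡ x y) (△-identityʳ x)
  (△-resp-≈ (inj₁ refl) (wt≡0 (x △ y) (trans (sym (dist≡wt x y)) e))))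

≈⇒dist≡0 : ∀ {n} {x y : X n} → x ≈ y → dist x y ≡ 0
≈⇒dist≡0 {n} {x} {y} p = n≤0⇒n≡0 (begin
  dist x y   ≡⟨ dist-resp-≈ {x = x} {x} (inj₁ refl) (≈-sym p) ⟩
  dist x x   ≡⟨ dist≡wt x x ⟩
  wt (x △ x) ≡⟨ cong wt (△-self x) ⟩
  wt {n} ⊥   ≤⟨ m⊓n≤m ∣ ⊥ {n} ∣ _ ⟩
  ∣ ⊥ {n} ∣  ≡⟨ ∣⊥∣≡0 n ⟩
  0          ∎)
  where open ≤-Reasoning

∣p△q∣≤∣p∣+∣q∣ : (u v : Subset n) → ∣ u △ v ∣ ≤ ∣ u ∣ + ∣ v ∣
∣p△q∣≤∣p∣+∣q∣ u v = subst (∣ u △ v ∣ ≤_) (∣p△q∣+2∣p∩q∣ u v) (m≤m+n _ _)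

wt-subadditive : (a b : Subset n) → wt (a △ b) ≤ wt a + wt b
wt-subadditive a b with wt-representative a | wt-representative b
... | a' , a≈a' , wt-a | b' , b≈b' , wt-b = begin
  wt (a △ b)      ≡⟨ wt-resp-≈ (△-resp-≈ a≈a' b≈b') ⟩
  wt (a' △ b')    ≤⟨ m⊓n≤m _ _ ⟩
  ∣ a' △ b' ∣     ≤⟨ ∣p△q∣≤∣p∣+∣q∣ a' b' ⟩
  ∣ a' ∣ + ∣ b' ∣ ≡⟨ cong₂ _+_ wt-a wt-b ⟨
  wt a + wt b     ∎
  where open ≤-Reasoning

dist-triangle : (x y z : X n) → dist x z ≤ dist x y + dist y z
dist-triangle x y z = begin
  dist x z                    ≡⟨ dist≡wt x z ⟩
  wt (x △ z)                  ≡⟨ cong wt (△-translate y x z) ⟨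
  wt ((y △ x) △ (y △ z))      ≡⟨ cong (λ w → wt (w △ (y △ z))) (△-comm y x) ⟩
  wt ((x △ y) △ (y △ z))      ≤⟨ wt-subadditive (x △ y) (y △ z) ⟩
  wt (x △ y) + wt (y △ z)     ≡⟨ cong₂ _+_ (dist≡wt x y) (dist≡wt y z) ⟨
  dist x y + dist y z         ∎
  where open ≤-Reasoning

remove-one : (w : Subset n) {k : ℕ} → ∣ w ∣ ≡ suc k → ∃ λ e → ∣ e ∣ ≡ 1 × ∣ e △ w ∣ ≡ k
remove-one {suc m} (true ∷ w) h =
  true ∷ ⊥ , cong suc (∣⊥∣≡0 m) , trans (cong ∣_∣ (△-identityˡ w)) (suc-injective h)
remove-one (false ∷ w) h with remove-one w h
... | e , ∣e∣≡1 , ∣e△w∣≡k = false ∷ e , ∣e∣≡1 , ∣e△w∣≡k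

geodesic-step : (x y : X n) {k : ℕ} → dist x y ≡ suc k → ∃ λ v → Adj x v × dist v y ≡ k
geodesic-step {n} x y {k} d with wt-representative (x △ y)
... | w , xy≈w , wt-xy with remove-one w (trans (sym wt-xy) (trans (sym (dist≡wt x y)) d))
... | e , ∣e∣≡1 , ∣e△w∣≡k = x △ e , adjacent , closer
  where
  ∣w∣≡1+k : ∣ w ∣ ≡ suc k
  ∣w∣≡1+k = trans (sym wt-xy) (trans (sym (dist≡wt x y)) d)
  half : suc k + suc k ≤ n
  half = begin
    suc k + suc k   ≡⟨ cong₂ _+_ ∣w∣≡1+k ∣w∣≡1+k ⟨
    ∣ w ∣ + ∣ w ∣   ≤⟨ +-monoʳ-≤ ∣ w ∣ (m⊓n≡m⇒m≤n (trans (wt-resp-≈ (≈-sym xy≈w)) wt-xy)) ⟩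
    ∣ w ∣ + ∣ ∁ w ∣ ≡⟨ ∣p∣+∣∁p∣≡n w ⟩
    n               ∎
    where open ≤-Reasoning
  adjacent : Adj x (x △ e)
  adjacent = begin
    dist x (x △ e)   ≡⟨ dist≡wt x (x △ e) ⟩
    wt (x △ (x △ e)) ≡⟨ cong wt (△-cancelˡ x e) ⟩
    wt e             ≡⟨ wt-small e (subst (λ m → m + m ≤ n) (sym ∣e∣≡1) (≤-trans (+-mono-≤ (s≤s z≤n) (s≤s z≤n)) half)) ⟩
    ∣ e ∣            ≡⟨ ∣e∣≡1 ⟩
    1                ∎
    where open ≡-Reasoning
  closer : dist (x △ e) y ≡ k
  closer = begin
    dist (x △ e) y   ≡⟨ dist≡wt (x △ e) y ⟩
    wt ((x △ e) △ y) ≡⟨ cong (λ u → wt (u △ y)) (△-comm x e) ⟩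
    wt ((e △ x) △ y) ≡⟨ cong wt (△-assoc e x y) ⟩
    wt (e △ (x △ y)) ≡⟨ wt-resp-≈ (△-resp-≈ {u = e} (inj₁ refl) xy≈w) ⟩
    wt (e △ w)       ≡⟨ wt-small (e △ w) (subst (λ m → m + m ≤ n) (sym ∣e△w∣≡k) (≤-trans (+-mono-≤ (n≤1+n k) (n≤1+n k)) half)) ⟩
    ∣ e △ w ∣        ≡⟨ ∣e△w∣≡k ⟩
    k                ∎
    where open ≡-Reasoning

adjacency-preserving⇒non-expanding :
  (f : X n → X n) → (∀ {x y} → x ≈ y → f x ≈ f y) → (∀ {x y} → Adj x y → Adj (f x) (f y)) →
  ∀ x y → dist (f x) (f y) ≤ dist x y
adjacency-preserving⇒non-expanding f f-resp f-adj x y = bounded (dist x y) x y refl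
  where
  bounded : ∀ k x y → dist x y ≡ k → dist (f x) (f y) ≤ k
  bounded zero    x y d = ≤-reflexive (≈⇒dist≡0 (f-resp (dist≡0⇒≈ x y d)))
  bounded (suc k) x y d with geodesic-step x y d
  ... | v , x~v , dist-vy = begin
    dist (f x) (f y)                    ≤⟨ dist-triangle (f x) (f v) (f y) ⟩
    dist (f x) (f v) + dist (f v) (f y) ≤⟨ +-mono-≤ (≤-reflexive (f-adj x~v)) (bounded k v y dist-vy) ⟩
    suc k                               ∎
    where open ≤-Reasoning

aut-preserves-dist : (σ : Aut n) (x y : X n) → dist (to σ x) (to σ y) ≡ dist x y
aut-preserves-dist σ x y = ≤-antisym
  (adjacency-preserving⇒non-expanding (to σ) (to-cong σ) (λ {u} {v} → Equivalence.to (adj σ u v)) x y)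
  (begin
    dist x y                               ≡⟨ dist-resp-≈ (≈-sym (from-to σ x)) (≈-sym (from-to σ y)) ⟩
    dist (from σ (to σ x)) (from σ (to σ y)) ≤⟨ adjacency-preserving⇒non-expanding (from σ) (from-cong σ) from-adj (to σ x) (to σ y) ⟩
    dist (to σ x) (to σ y)                 ∎)
  where
  open ≤-Reasoning
  from-adj : ∀ {u v} → Adj u v → Adj (from σ u) (from σ v)
  from-adj {u} {v} u~v = Equivalence.from (adj σ (from σ u) (from σ v))
    (trans (dist-resp-≈ (to-from σ u) (to-from σ v)) u~v)

lookup-ext : {u v : Vec A n} → (∀ i → lookup u i ≡ lookup v i) → u ≡ v
lookup-ext {u = u} {v} h = trans (sym (tabulate∘lookup u)) (trans (tabulate-cong h) (tabulate∘lookup v))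

permute : Permutation′ n → Vec A n → Vec A n
permute π v = tabulate (λ i → lookup v (π ⟨$⟩ʳ i))

lookup-permute : (π : Permutation′ n) (v : Vec A n) (i : Fin n) → lookup (permute π v) i ≡ lookup v (π ⟨$⟩ʳ i)
lookup-permute π v = lookup∘tabulate (λ i → lookup v (π ⟨$⟩ʳ i))

permute-zipWith : (f : A → B → C) (π : Permutation′ n) (u : Vec A n) (v : Vec B n) →
                  permute π (zipWith f u v) ≡ zipWith f (permute π u) (permute π v)
permute-zipWith f π u v = lookup-ext λ i → begin
  lookup (permute π (zipWith f u v)) i                    ≡⟨ lookup-permute π (zipWith f u v) i ⟩
  lookup (zipWith f u v) (π ⟨$⟩ʳ i)                       ≡⟨ lookup-zipWith f (π ⟨$⟩ʳ i) u v ⟩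
  f (lookup u (π ⟨$⟩ʳ i)) (lookup v (π ⟨$⟩ʳ i))           ≡⟨ cong₂ f (lookup-permute π u i) (lookup-permute π v i) ⟨
  f (lookup (permute π u) i) (lookup (permute π v) i)     ≡⟨ lookup-zipWith f i (permute π u) (permute π v) ⟨
  lookup (zipWith f (permute π u) (permute π v)) i        ∎
  where open ≡-Reasoning

permute-map : (f : A → B) (π : Permutation′ n) (u : Vec A n) → permute π (map f u) ≡ map f (permute π u)
permute-map f π u = lookup-ext λ i → begin
  lookup (permute π (map f u)) i ≡⟨ lookup-permute π (map f u) i ⟩
  lookup (map f u) (π ⟨$⟩ʳ i)    ≡⟨ lookup-map (π ⟨$⟩ʳ i) f u ⟩
  f (lookup u (π ⟨$⟩ʳ i))        ≡⟨ cong f (lookup-permute π u i) ⟨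
  f (lookup (permute π u) i)     ≡⟨ lookup-map i f (permute π u) ⟨
  lookup (map f (permute π u)) i ∎
  where open ≡-Reasoning

permute-∘ : (π ρ : Permutation′ n) (v : Vec A n) → permute (π ∘ₚ ρ) v ≡ permute π (permute ρ v)
permute-∘ π ρ v = lookup-ext λ i → begin
  lookup (permute (π ∘ₚ ρ) v) i        ≡⟨ lookup-permute (π ∘ₚ ρ) v i ⟩
  lookup v (ρ ⟨$⟩ʳ (π ⟨$⟩ʳ i))         ≡⟨ lookup-permute ρ v (π ⟨$⟩ʳ i) ⟨
  lookup (permute ρ v) (π ⟨$⟩ʳ i)      ≡⟨ lookup-permute π (permute ρ v) i ⟨
  lookup (permute π (permute ρ v)) i   ∎
  where open ≡-Reasoning

permute-inverse : (π : Permutation′ n) (v : Vec A n) → permute (flip π) (permute π v) ≡ v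
permute-inverse π v = lookup-ext λ i → begin
  lookup (permute (flip π) (permute π v)) i ≡⟨ lookup-permute (flip π) (permute π v) i ⟩
  lookup (permute π v) (flip π ⟨$⟩ʳ i)      ≡⟨ lookup-permute π v (flip π ⟨$⟩ʳ i) ⟩
  lookup v (π ⟨$⟩ʳ (flip π ⟨$⟩ʳ i))         ≡⟨ cong (lookup v) (inverseʳ π) ⟩
  lookup v i                                ∎
  where open ≡-Reasoning

module _ {P : Pred A 0ℓ} (P? : Decidable P) where

  -- count as a sum of indicators, to which the library's invariance of finite sums
  -- under permutations applies.
  indicator : A → ℕ
  indicator x = if does (P? x) then 1 else 0

  count-∷ : (x : A) (v : Vec A n) → count P? (x ∷ v) ≡ indicator x + count P? v
  count-∷ x v with does (P? x)
  ... | true  = refl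
  ... | false = refl

  count≡sum : (v : Vec A n) → count P? v ≡ sum (λ i → indicator (lookup v i))
  count≡sum []      = refl
  count≡sum (x ∷ v) = trans (count-∷ x v) (cong (indicator x +_) (count≡sum v))

  count-permute : (π : Permutation′ n) (v : Vec A n) → count P? (permute π v) ≡ count P? v
  count-permute π v = begin
    count P? (permute π v)                              ≡⟨ count≡sum (permute π v) ⟩
    sum (λ i → indicator (lookup (permute π v) i))      ≡⟨ sum-cong-≗ (λ i → cong indicator (lookup-permute π v i)) ⟩
    sum (λ i → indicator (lookup v (π ⟨$⟩ʳ i)))         ≡⟨ sum-permute (λ i → indicator (lookup v i)) π ⟨
    sum (λ i → indicator (lookup v i))                  ≡⟨ count≡sum v ⟨
    count P? v                                          ∎
    where open ≡-Reasoning

  count-pos⇒witness : (v : Vec A n) → 1 ≤ count P? v → ∃ λ i → P (lookup v i)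
  count-pos⇒witness (x ∷ v) h with P? x
  ... | yes px = zero , px
  ... | no _ with count-pos⇒witness v h
  ...   | i , pi = suc i , pi

module _ (_≟_ : DecidableEquality A) where

  multiplicity : A → Vec A n → ℕ
  multiplicity a = count (_≟ a)

  occurs-at-head : (a : A) (u : Vec A n) → 1 ≤ multiplicity a (a ∷ u)
  occurs-at-head a u = subst (1 ≤_) (sym (count-∷ (_≟ a) a u))
    (subst (λ b → 1 ≤ (if b then 1 else 0) + multiplicity a u) (sym (dec-true (a ≟ a) refl)) (s≤s z≤n))

  cancel-head : (a : A) (u w : Vec A n) → (∀ b → multiplicity b (a ∷ u) ≡ multiplicity b (a ∷ w)) →
                ∀ b → multiplicity b u ≡ multiplicity b w
  cancel-head a u w same b = +-cancelˡ-≡ (indicator (_≟ b) a) _ _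
    (trans (sym (count-∷ (_≟ b) a u)) (trans (same b) (count-∷ (_≟ b) a w)))

  move-to-front : (a : A) (v : Vec A (suc n)) → 1 ≤ multiplicity a v →
                  ∃ λ τ → ∃ λ w → permute τ v ≡ a ∷ w
  move-to-front a v a∈v with count-pos⇒witness (_≟ a) v a∈v
  ... | k , vₖ≡a = transpose zero k , tail (permute (transpose zero k) v) , cong (_∷ _) vₖ≡a

  equal-multiplicities⇒permute : (u v : Vec A n) → (∀ a → multiplicity a u ≡ multiplicity a v) →
                                 ∃ λ π → permute π u ≡ v
  equal-multiplicities⇒permute []      []      _    = Perm.id , refl
  equal-multiplicities⇒permute (a ∷ u) v       same
    with move-to-front a v (subst (1 ≤_) (same a) (occurs-at-head a u))
  ... | τ , w , τv≡a∷w
    with equal-multiplicities⇒permute u w (cancel-head a u w λ b →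
           trans (same b) (trans (sym (count-permute (_≟ b) τ v)) (cong (multiplicity b) τv≡a∷w)))
  ... | ρ , ρu≡w = flip τ ∘ₚ lift₀ ρ , (begin
    permute (flip τ ∘ₚ lift₀ ρ) (a ∷ u) ≡⟨ permute-∘ (flip τ) (lift₀ ρ) (a ∷ u) ⟩
    permute (flip τ) (a ∷ permute ρ u)  ≡⟨ cong (λ w' → permute (flip τ) (a ∷ w')) ρu≡w ⟩
    permute (flip τ) (a ∷ w)            ≡⟨ cong (permute (flip τ)) τv≡a∷w ⟨
    permute (flip τ) (permute τ v)      ≡⟨ permute-inverse τ v ⟩
    v                                   ∎)
    where open ≡-Reasoning

-- A pair of subsets P, Q colours each coordinate by its membership pattern (∈ P, ∈ Q);
-- #[ c ] counts coordinates of colour c.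

_≟ᶜ_ : DecidableEquality (Bool × Bool)
_≟ᶜ_ = ≡-dec Bool._≟_ Bool._≟_

#[_] : Bool × Bool → Vec (Bool × Bool) n → ℕ
#[ c ] = multiplicity _≟ᶜ_ c

#tt≡∣P∩Q∣ : (P Q : Subset n) → #[ true , true ] (zip P Q) ≡ ∣ P ∩ Q ∣
#tt≡∣P∩Q∣ []          []          = refl
#tt≡∣P∩Q∣ (true ∷ P)  (true ∷ Q)  = cong suc (#tt≡∣P∩Q∣ P Q)
#tt≡∣P∩Q∣ (true ∷ P)  (false ∷ Q) = #tt≡∣P∩Q∣ P Q
#tt≡∣P∩Q∣ (false ∷ P) (true ∷ Q)  = #tt≡∣P∩Q∣ P Q
#tt≡∣P∩Q∣ (false ∷ P) (false ∷ Q) = #tt≡∣P∩Q∣ P Q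

#tt+#tf≡∣P∣ : (P Q : Subset n) → #[ true , true ] (zip P Q) + #[ true , false ] (zip P Q) ≡ ∣ P ∣
#tt+#tf≡∣P∣ []          []          = refl
#tt+#tf≡∣P∣ (true ∷ P)  (true ∷ Q)  = cong suc (#tt+#tf≡∣P∣ P Q)
#tt+#tf≡∣P∣ (true ∷ P)  (false ∷ Q) = trans (+-suc _ _) (cong suc (#tt+#tf≡∣P∣ P Q))
#tt+#tf≡∣P∣ (false ∷ P) (true ∷ Q)  = #tt+#tf≡∣P∣ P Q
#tt+#tf≡∣P∣ (false ∷ P) (false ∷ Q) = #tt+#tf≡∣P∣ P Q

#tt+#ft≡∣Q∣ : (P Q : Subset n) → #[ true , true ] (zip P Q) + #[ false , true ] (zip P Q) ≡ ∣ Q ∣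
#tt+#ft≡∣Q∣ []          []          = refl
#tt+#ft≡∣Q∣ (true ∷ P)  (true ∷ Q)  = cong suc (#tt+#ft≡∣Q∣ P Q)
#tt+#ft≡∣Q∣ (true ∷ P)  (false ∷ Q) = #tt+#ft≡∣Q∣ P Q
#tt+#ft≡∣Q∣ (false ∷ P) (true ∷ Q)  = trans (+-suc _ _) (cong suc (#tt+#ft≡∣Q∣ P Q))
#tt+#ft≡∣Q∣ (false ∷ P) (false ∷ Q) = #tt+#ft≡∣Q∣ P Q

#-total : (P Q : Subset n) → let K = zip P Q in
  #[ true , true ] K + #[ true , false ] K + #[ false , true ] K + #[ false , false ] K ≡ n
#-total []          []          = refl
#-total (true ∷ P)  (true ∷ Q)  = cong suc (#-total P Q)
#-total (true ∷ P)  (false ∷ Q) =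
  trans (cong (λ m → m + #[ false , true ] K + #[ false , false ] K) (+-suc (#[ true , true ] K) (#[ true , false ] K)))
        (cong suc (#-total P Q))
  where K = zip P Q
#-total (false ∷ P) (true ∷ Q)  =
  trans (cong (_+ #[ false , false ] K) (+-suc (#[ true , true ] K + #[ true , false ] K) (#[ false , true ] K)))
        (cong suc (#-total P Q))
  where K = zip P Q
#-total (false ∷ P) (false ∷ Q) = trans (+-suc _ _) (cong suc (#-total P Q))

same-colour-counts : (P Q P' Q' : Subset n) →
  ∣ P ∣ ≡ ∣ P' ∣ → ∣ Q ∣ ≡ ∣ Q' ∣ → ∣ P ∩ Q ∣ ≡ ∣ P' ∩ Q' ∣ →
  ∀ c → #[ c ] (zip P Q) ≡ #[ c ] (zip P' Q')
same-colour-counts P Q P' Q' ∣P∣≡ ∣Q∣≡ ∣P∩Q∣≡ = λ where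
    (true , true)   → tt
    (true , false)  → tf
    (false , true)  → ft
    (false , false) → ff
  where
  K = zip P Q
  K' = zip P' Q'
  tt : #[ true , true ] K ≡ #[ true , true ] K'
  tt = trans (#tt≡∣P∩Q∣ P Q) (trans ∣P∩Q∣≡ (sym (#tt≡∣P∩Q∣ P' Q')))
  tf : #[ true , false ] K ≡ #[ true , false ] K'
  tf = +-cancelˡ-≡ (#[ true , true ] K) _ _
         (trans (#tt+#tf≡∣P∣ P Q) (trans ∣P∣≡ (trans (sym (#tt+#tf≡∣P∣ P' Q')) (cong (_+ _) (sym tt)))))
  ft : #[ false , true ] K ≡ #[ false , true ] K'
  ft = +-cancelˡ-≡ (#[ true , true ] K) _ _
         (trans (#tt+#ft≡∣Q∣ P Q) (trans ∣Q∣≡ (trans (sym (#tt+#ft≡∣Q∣ P' Q')) (cong (_+ _) (sym tt)))))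
  ff : #[ false , false ] K ≡ #[ false , false ] K'
  ff = +-cancelˡ-≡ (#[ true , true ] K + #[ true , false ] K + #[ false , true ] K) _ _
         (trans (#-total P Q) (trans (sym (#-total P' Q'))
           (cong (_+ #[ false , false ] K') (sym (cong₂ _+_ (cong₂ _+_ tt tf) ft)))))

permute-unzip : (π : Permutation′ n) (P Q P' Q' : Subset n) →
  permute π (zip P Q) ≡ zip P' Q' → permute π P ≡ P' × permute π Q ≡ Q'
permute-unzip {n} π P Q P' Q' πK≡K' =
  along proj₁ (map-proj₁-zip P Q) (map-proj₁-zip P' Q') , along proj₂ (map-proj₂-zip P Q) (map-proj₂-zip P' Q')
  where
  along : (pr : Bool × Bool → Bool) {R R' : Subset n} →
          map pr (zip P Q) ≡ R → map pr (zip P' Q') ≡ R' → permute π R ≡ R'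
  along pr refl refl = trans (permute-map pr π (zip P Q)) (cong (map pr) πK≡K')

pair-transport : (P Q P' Q' : Subset n) →
  ∣ P ∣ ≡ ∣ P' ∣ → ∣ Q ∣ ≡ ∣ Q' ∣ → ∣ P ∩ Q ∣ ≡ ∣ P' ∩ Q' ∣ →
  ∃ λ π → permute π P ≡ P' × permute π Q ≡ Q'
pair-transport P Q P' Q' ∣P∣≡ ∣Q∣≡ ∣P∩Q∣≡
  with equal-multiplicities⇒permute _≟ᶜ_ (zip P Q) (zip P' Q') (same-colour-counts P Q P' Q' ∣P∣≡ ∣Q∣≡ ∣P∩Q∣≡)
... | π , πK≡K' = π , permute-unzip π P Q P' Q' πK≡K'

△-translateʳ : (u v w : Subset n) → (u △ w) △ (v △ w) ≡ u △ v
△-translateʳ u v w = trans (cong₂ _△_ (△-comm u w) (△-comm v w)) (△-translate w u v)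

wt-permute : (π : Permutation′ n) (w : Subset n) → wt (permute π w) ≡ wt w
wt-permute π w = cong₂ _⊓_ (count-permute (Bool._≟ true) π w)
  (trans (cong ∣_∣ (sym (permute-map not π w))) (count-permute (Bool._≟ true) π (∁ w)))

shift : Permutation′ n → Subset n → Subset n → Subset n → Subset n
shift π a b u = permute π (u △ a) △ b

module _ (π : Permutation′ n) (a b : Subset n) where

  shift-∁ : (u : Subset n) → shift π a b (∁ u) ≡ ∁ (shift π a b u)
  shift-∁ u = begin
    permute π (∁ u △ a) △ b   ≡⟨ cong (λ w → permute π w △ b) (∁-△ˡ u a) ⟩
    permute π (∁ (u △ a)) △ b ≡⟨ cong (_△ b) (permute-map not π (u △ a)) ⟩
    ∁ (permute π (u △ a)) △ b ≡⟨ ∁-△ˡ (permute π (u △ a)) b ⟩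
    ∁ (shift π a b u)         ∎
    where open ≡-Reasoning

  shift-inverse : (u : Subset n) → shift (flip π) b a (shift π a b u) ≡ u
  shift-inverse u = begin
    permute (flip π) ((permute π (u △ a) △ b) △ b) △ a ≡⟨ cong (λ w → permute (flip π) w △ a) (△-cancelʳ (permute π (u △ a)) b) ⟩
    permute (flip π) (permute π (u △ a)) △ a           ≡⟨ cong (_△ a) (permute-inverse π (u △ a)) ⟩
    (u △ a) △ a                                        ≡⟨ △-cancelʳ u a ⟩
    u                                                  ∎
    where open ≡-Reasoning

  shift-dist : (u v : Subset n) → dist (shift π a b u) (shift π a b v) ≡ dist u v
  shift-dist u v = begin
    dist (shift π a b u) (shift π a b v)       ≡⟨ dist≡wt (shift π a b u) (shift π a b v) ⟩
    wt (shift π a b u △ shift π a b v)         ≡⟨ cong wt (△-translateʳ (permute π (u △ a)) (permute π (v △ a)) b) ⟩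
    wt (permute π (u △ a) △ permute π (v △ a)) ≡⟨ cong wt (permute-zipWith _xor_ π (u △ a) (v △ a)) ⟨
    wt (permute π ((u △ a) △ (v △ a)))         ≡⟨ wt-permute π ((u △ a) △ (v △ a)) ⟩
    wt ((u △ a) △ (v △ a))                     ≡⟨ cong wt (△-translateʳ u v a) ⟩
    wt (u △ v)                                 ≡⟨ dist≡wt u v ⟨
    dist u v                                   ∎
    where open ≡-Reasoning

shift-aut : Permutation′ n → Subset n → Subset n → Aut n
shift-aut π a b = record
  { to        = shift π a b
  ; from      = shift (flip π) b a
  ; to-cong   = ∁-natural⇒≈-resp (shift π a b) (shift-∁ π a b)
  ; from-cong = ∁-natural⇒≈-resp (shift (flip π) b a) (shift-∁ (flip π) b a)
  ; to-from   = λ u → inj₁ (shift-inverse (flip π) b a u)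
  ; from-to   = λ u → inj₁ (shift-inverse π a b u)
  ; adj       = λ u v → mk⇔ (trans (shift-dist π a b u v)) (trans (sym (shift-dist π a b u v)))
  }

δ : X n → X n → Subset n
δ x y = x △ label x y

label-≈ : (x y : X n) → label x y ≈ y
label-≈ x y with ∣ x △ y ∣ ≤ᵇ ∣ x △ ∁ y ∣
... | true  = inj₁ refl
... | false = inj₂ refl

∣δ∣≡dist : (x y : X n) → ∣ δ x y ∣ ≡ dist x y
∣δ∣≡dist x y with ∣ x △ y ∣ ≤ᵇ ∣ x △ ∁ y ∣
... | true  = refl
... | false = refl

label-near : (x y : X n) → ∣ x △ y ∣ ≤ ∣ x △ ∁ y ∣ → label x y ≡ y
label-near x y near with ∣ x △ y ∣ ≤ᵇ ∣ x △ ∁ y ∣ in eq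
... | true  = refl
... | false = ⊥-elim (subst T eq (≤⇒≤ᵇ near))

dist-via-δ : (x y z : X n) → dist y z ≡ wt (δ x y △ δ x z)
dist-via-δ x y z = begin
  dist y z                       ≡⟨ dist-resp-≈ (≈-sym (label-≈ x y)) (≈-sym (label-≈ x z)) ⟩
  dist (label x y) (label x z)   ≡⟨ dist≡wt (label x y) (label x z) ⟩
  wt (label x y △ label x z)     ≡⟨ cong wt (△-translate x (label x y) (label x z)) ⟨
  wt (δ x y △ δ x z)             ∎
  where open ≡-Reasoning

odd≢even : ∀ a b → suc (a + a) ≢ b + b
odd≢even zero    zero    ()
odd≢even zero    (suc b) e = 0≢1+n (trans (suc-injective e) (+-suc b b))
odd≢even (suc a) zero    ()
odd≢even (suc a) (suc b) e =
  odd≢even a b (suc-injective (trans (sym (+-suc (suc a) a)) (trans (suc-injective e) (+-suc b b))))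

Odd : ℕ → Set
Odd n = ∃ λ h → n ≡ suc (h + h)

parity-clash : Odd n → ∀ s s' t t' → s + s' ≡ n → s + (t + t) ≢ s' + (t' + t')
parity-clash (h , refl) s s' t t' total e = odd≢even (h + t) (s' + t') (begin
  suc ((h + t) + (h + t))   ≡⟨ solve 2 (λ h t → con 1 :+ ((h :+ t) :+ (h :+ t)) := (con 1 :+ (h :+ h)) :+ (t :+ t)) refl h t ⟩
  suc (h + h) + (t + t)     ≡⟨ cong (_+ (t + t)) total ⟨
  (s + s') + (t + t)        ≡⟨ solve 3 (λ s s' t → (s :+ s') :+ (t :+ t) := (s :+ (t :+ t)) :+ s') refl s s' t ⟩
  (s + (t + t)) + s'        ≡⟨ cong (_+ s') e ⟩
  (s' + (t' + t')) + s'     ≡⟨ solve 2 (λ s' t' → (s' :+ (t' :+ t')) :+ s' := (s' :+ t') :+ (s' :+ t')) refl s' t' ⟩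
  (s' + t') + (s' + t')     ∎)
  where open ≡-Reasoning
        open +-*-Solver

size-from-weight : Odd n → (w w' : Subset n) (t t' : ℕ) →
  ∣ w ∣ + (t + t) ≡ ∣ w' ∣ + (t' + t') → wt w ≡ wt w' → ∣ w ∣ ≡ ∣ w' ∣
size-from-weight odd w w' t t' e same with ⊓-sel ∣ w ∣ ∣ ∁ w ∣ | ⊓-sel ∣ w' ∣ ∣ ∁ w' ∣
... | inj₁ wt≡ | inj₁ wt'≡ = trans (sym wt≡) (trans same wt'≡)
... | inj₂ wt≡ | inj₂ wt'≡ = +-cancelʳ-≡ (∣ ∁ w ∣) (∣ w ∣) (∣ w' ∣)
      (trans (∣p∣+∣∁p∣≡n w) (trans (sym (∣p∣+∣∁p∣≡n w')) (cong (∣ w' ∣ +_) (trans (sym wt'≡) (trans (sym same) wt≡)))))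
... | inj₁ wt≡ | inj₂ wt'≡ = ⊥-elim (parity-clash odd (∣ w ∣) (∣ w' ∣) t t'
      (trans (cong (_+ ∣ w' ∣) (trans (sym wt≡) (trans same wt'≡))) (trans (+-comm ∣ ∁ w' ∣ ∣ w' ∣) (∣p∣+∣∁p∣≡n w'))) e)
... | inj₂ wt≡ | inj₁ wt'≡ = ⊥-elim (parity-clash odd (∣ w' ∣) (∣ w ∣) t' t
      (trans (cong (_+ ∣ w ∣) (trans (sym wt'≡) (trans (sym same) wt≡))) (trans (+-comm ∣ ∁ w ∣ ∣ w ∣) (∣p∣+∣∁p∣≡n w))) (sym e))

double-injective : ∀ a b → a + a ≡ b + b → a ≡ b
double-injective a b e with <-cmp a b
... | tri< a<b _ _ = ⊥-elim (<-irrefl e (+-mono-< a<b a<b))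
... | tri≈ _ a≡b _ = a≡b
... | tri> _ _ b<a = ⊥-elim (<-irrefl (sym e) (+-mono-< b<a b<a))

∂₃-from-distances : Odd n → (x y z x' y' z' : X n) →
  dist x y ≡ dist x' y' → dist x z ≡ dist x' z' → dist y z ≡ dist y' z' → ∂₃ x y z ≡ ∂₃ x' y' z'
∂₃-from-distances {n} odd x y z x' y' z' xy xz yz = cong₂ _,_ xy (cong₂ _,_ xz t≡t')
  where
  sizes : (x y z : X n) → ∣ δ x y △ δ x z ∣ + (∣ δ x y ∩ δ x z ∣ + ∣ δ x y ∩ δ x z ∣) ≡ dist x y + dist x z
  sizes x y z = trans (∣p△q∣+2∣p∩q∣ (δ x y) (δ x z)) (cong₂ _+_ (∣δ∣≡dist x y) (∣δ∣≡dist x z))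
  e : ∣ δ x y △ δ x z ∣ + (∣ δ x y ∩ δ x z ∣ + ∣ δ x y ∩ δ x z ∣)
    ≡ ∣ δ x' y' △ δ x' z' ∣ + (∣ δ x' y' ∩ δ x' z' ∣ + ∣ δ x' y' ∩ δ x' z' ∣)
  e = trans (sizes x y z) (trans (cong₂ _+_ xy xz) (sym (sizes x' y' z')))
  same-size : ∣ δ x y △ δ x z ∣ ≡ ∣ δ x' y' △ δ x' z' ∣
  same-size = size-from-weight odd (δ x y △ δ x z) (δ x' y' △ δ x' z') (∣ δ x y ∩ δ x z ∣) (∣ δ x' y' ∩ δ x' z' ∣) e
                (trans (sym (dist-via-δ x y z)) (trans yz (dist-via-δ x' y' z')))
  t≡t' : ∣ δ x y ∩ δ x z ∣ ≡ ∣ δ x' y' ∩ δ x' z' ∣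
  t≡t' = double-injective t t' (+-cancelˡ-≡ (∣ δ x y △ δ x z ∣) (t + t) (t' + t')
           (trans e (cong (_+ (t' + t')) (sym same-size))))
    where t = ∣ δ x y ∩ δ x z ∣
          t' = ∣ δ x' y' ∩ δ x' z' ∣

half-bound : ∀ a h → a + a ≤ suc (h + h) → a ≤ h
half-bound a h a+a≤ with a ≤? h
... | yes a≤h = a≤h
... | no  a≰h = ⊥-elim (1+n≰n (≤-trans (≤-reflexive (sym (+-suc (suc h) h))) (≤-trans (+-mono-≤ h<a h<a) a+a≤)))
  where h<a = ≰⇒> a≰h

dist-bound : ∀ h (x y : X (suc (h + h))) → dist x y ≤ h
dist-bound h x y = half-bound (dist x y) h (begin
  dist x y + dist x y           ≡⟨ cong (λ d → d + d) (dist≡wt x y) ⟩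
  wt (x △ y) + wt (x △ y)       ≤⟨ +-mono-≤ (m⊓n≤m ∣ x △ y ∣ ∣ ∁ (x △ y) ∣) (m⊓n≤n ∣ x △ y ∣ ∣ ∁ (x △ y) ∣) ⟩
  ∣ x △ y ∣ + ∣ ∁ (x △ y) ∣     ≡⟨ ∣p∣+∣∁p∣≡n (x △ y) ⟩
  suc (h + h)                   ∎)
  where open ≤-Reasoning

∂₃∈I′ : ∀ D (x y z : X (suc (D + D))) → InI' D (∂₃ x y z)
∂₃∈I′ D x y z =
    subst (∣ δ x y ∩ δ x z ∣ ≤_) (∣δ∣≡dist x y) (∣p∩q∣≤∣p∣ (δ x y) (δ x z))
  , subst (∣ δ x y ∩ δ x z ∣ ≤_) (∣δ∣≡dist x z) (∣p∩q∣≤∣q∣ (δ x y) (δ x z))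
  , dist-bound D x y
  , dist-bound D x z
  , ≤-trans (+-mono-≤ (dist-bound D x y) (dist-bound D x z)) (m≤m+n (D + D) _)

small-set : ∀ h (y : Subset (suc (h + h))) → ∣ y ∣ ≤ h → ∣ y ∣ ≤ ∣ ∁ y ∣
small-set h y ∣y∣≤h = +-cancelˡ-≤ (∣ y ∣) (∣ y ∣) (∣ ∁ y ∣)
  (≤-trans (+-mono-≤ ∣y∣≤h ∣y∣≤h) (≤-trans (n≤1+n (h + h)) (≤-reflexive (sym (∣p∣+∣∁p∣≡n y)))))

δ𝟎-small : ∀ h (y : X (suc (h + h))) → ∣ y ∣ ≤ h → δ 𝟎 y ≡ y
δ𝟎-small h y ∣y∣≤h = trans (cong (⊥ △_) (label-near ⊥ y near)) (△-identityˡ y)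
  where
  near : ∣ ⊥ △ y ∣ ≤ ∣ ⊥ △ ∁ y ∣
  near = subst₂ (λ u v → ∣ u ∣ ≤ ∣ v ∣) (sym (△-identityˡ y)) (sym (△-identityˡ (∁ y))) (small-set h y ∣y∣≤h)

∂₃-from-𝟎 : ∀ h (y z : X (suc (h + h))) → ∣ y ∣ ≤ h → ∣ z ∣ ≤ h → ∂₃ 𝟎 y z ≡ (∣ y ∣ , ∣ z ∣ , ∣ y ∩ z ∣)
∂₃-from-𝟎 h y z ∣y∣≤h ∣z∣≤h = cong₂ _,_ (size y ∣y∣≤h) (cong₂ _,_ (size z ∣z∣≤h)
  (cong₂ (λ u v → ∣ u ∩ v ∣) (δ𝟎-small h y ∣y∣≤h) (δ𝟎-small h z ∣z∣≤h)))
  where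
  size : (u : X (suc (h + h))) → ∣ u ∣ ≤ h → dist 𝟎 u ≡ ∣ u ∣
  size u ∣u∣≤h = trans (sym (∣δ∣≡dist 𝟎 u)) (cong ∣_∣ (δ𝟎-small h u ∣u∣≤h))

interval : ℕ → ℕ → (m : ℕ) → Subset m
interval zero    zero    m       = ⊥
interval zero    (suc k) zero    = []
interval zero    (suc k) (suc m) = true ∷ interval zero k m
interval (suc l) k       zero    = []
interval (suc l) k       (suc m) = false ∷ interval l k m

∣interval∣ : ∀ l k m → l + k ≤ m → ∣ interval l k m ∣ ≡ k
∣interval∣ zero    zero    m       _       = ∣⊥∣≡0 m
∣interval∣ zero    (suc k) (suc m) (s≤s h) = cong suc (∣interval∣ zero k m h)
∣interval∣ (suc l) k       (suc m) (s≤s h) = ∣interval∣ l k m h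

initial-overlap : ∀ i k m → i ≤ k → k ≤ m → ∣ interval 0 i m ∩ interval 0 k m ∣ ≡ i
initial-overlap zero    k       m       _       _       = trans (cong ∣_∣ (∩-zeroˡ (interval 0 k m))) (∣⊥∣≡0 m)
initial-overlap (suc i) (suc k) (suc m) (s≤s a) (s≤s b) = cong suc (initial-overlap i k m a b)

interval-overlap : ∀ i l k m → l ≤ i → i ≤ l + k → l + k ≤ m → ∣ interval 0 i m ∩ interval l k m ∣ ≡ i ∸ l
interval-overlap i       zero    k m       _       i≤k   k≤m     = initial-overlap i k m i≤k k≤m
interval-overlap (suc i) (suc l) k (suc m) (s≤s a) i≤l+k (s≤s b) = interval-overlap i l k m a (≤-pred i≤l+k) b

shifted-fits : ∀ {i j t m} → t ≤ i → i + j ≤ m + t → (i ∸ t) + j ≤ m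
shifted-fits {i} {j} {t} {m} t≤i i+j≤ = +-cancelʳ-≤ t (i ∸ t + j) m (begin
  i ∸ t + j + t  ≡⟨ solve 3 (λ l j t → l :+ j :+ t := (l :+ t) :+ j) refl (i ∸ t) j t ⟩
  i ∸ t + t + j  ≡⟨ cong (_+ j) (m∸n+n≡m t≤i) ⟩
  i + j          ≤⟨ i+j≤ ⟩
  m + t          ∎)
  where open +-*-Solver
        open ≤-Reasoning

-- Every (i, j, t) ∈ I′ is ∂(0, y, z) with y = [0, i) and z = [i − t, i − t + j).
realise-from-𝟎 : ∀ D i j t → InI' D (i , j , t) →
  ∃ λ (y : X (suc (D + D))) → ∃ λ z → ∂₃ 𝟎 y z ≡ (i , j , t)
realise-from-𝟎 D i j t (t≤i , t≤j , i≤D , j≤D , i+j≤) = y , z , (begin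
  ∂₃ 𝟎 y z                        ≡⟨ ∂₃-from-𝟎 D y z (subst (_≤ D) (sym ∣y∣≡i) i≤D) (subst (_≤ D) (sym ∣z∣≡j) j≤D) ⟩
  (∣ y ∣ , ∣ z ∣ , ∣ y ∩ z ∣)     ≡⟨ cong₂ _,_ ∣y∣≡i (cong₂ _,_ ∣z∣≡j ∣y∩z∣≡t) ⟩
  (i , j , t)                     ∎)
  where
  open ≡-Reasoning
  N = suc (D + D)
  l = i ∸ t
  y = interval 0 i N
  z = interval l j N
  l+t≡i : l + t ≡ i
  l+t≡i = m∸n+n≡m t≤i
  l+j≤N : l + j ≤ N
  l+j≤N = m≤n⇒m≤1+n (shifted-fits t≤i i+j≤)
  ∣y∣≡i : ∣ y ∣ ≡ i
  ∣y∣≡i = ∣interval∣ 0 i N (m≤n⇒m≤1+n (≤-trans i≤D (m≤m+n D D)))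
  ∣z∣≡j : ∣ z ∣ ≡ j
  ∣z∣≡j = ∣interval∣ l j N l+j≤N
  ∣y∩z∣≡t : ∣ y ∩ z ∣ ≡ t
  ∣y∩z∣≡t = trans (interval-overlap i l j N (m∸n≤m i t) (subst (_≤ l + j) l+t≡i (+-monoʳ-≤ l t≤j)) l+j≤N)
                  (m∸[m∸n]≡n t≤i)

-- Automorphisms preserve ∂ (in odd dimension, where ∂ is a function of the distances).
same-orbit⇒same-∂ : Odd n → (x y z x' y' z' : X n) → SameOrbit₃ x y z x' y' z' → ∂₃ x y z ≡ ∂₃ x' y' z'
same-orbit⇒same-∂ odd x y z x' y' z' (σ , σx≈x' , σy≈y' , σz≈z') =
  ∂₃-from-distances odd x y z x' y' z' (moved σx≈x' σy≈y') (moved σx≈x' σz≈z') (moved σy≈y' σz≈z')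
  where
  moved : ∀ {u v u' v'} → to σ u ≈ u' → to σ v ≈ v' → dist u v ≡ dist u' v'
  moved {u} {v} σu≈u' σv≈v' = trans (sym (aut-preserves-dist σ u v)) (dist-resp-≈ σu≈u' σv≈v')

same-∂⇒same-orbit : (x y z x' y' z' : X n) → ∂₃ x y z ≡ ∂₃ x' y' z' → SameOrbit₃ x y z x' y' z'
same-∂⇒same-orbit x y z x' y' z' same with pair-transport (δ x y) (δ x z) (δ x' y') (δ x' z')
    (trans (∣δ∣≡dist x y) (trans (cong proj₁ same) (sym (∣δ∣≡dist x' y'))))
    (trans (∣δ∣≡dist x z) (trans (cong (proj₁ ∘′ proj₂) same) (sym (∣δ∣≡dist x' z'))))
    (cong (proj₂ ∘′ proj₂) same)
... | π , πδy , πδz = σ , inj₁ σx≡x' , carries y y' πδy , carries z z' πδz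
  where
  σ = shift-aut π x x'
  σx≡x' : shift π x x' x ≡ x'
  σx≡x' = begin
    permute π (x △ x) △ x'               ≡⟨ cong (_△ x') (permute-zipWith _xor_ π x x) ⟩
    (permute π x △ permute π x) △ x'     ≡⟨ cong (_△ x') (△-self (permute π x)) ⟩
    ⊥ △ x'                               ≡⟨ △-identityˡ x' ⟩
    x'                                   ∎
    where open ≡-Reasoning
  -- σ sends the representative of y nearest to x to the representative of y' nearest to x'.
  carries : (y y' : X _) → permute π (δ x y) ≡ δ x' y' → to σ y ≈ y'
  carries y y' πδ = ≈-trans (to-cong σ (≈-sym (label-≈ x y))) (≈-trans (inj₁ labels) (label-≈ x' y'))
    where
    labels : shift π x x' (label x y) ≡ label x' y'
    labels = begin
      permute π (label x y △ x) △ x' ≡⟨ cong (λ w → permute π w △ x') (△-comm (label x y) x) ⟩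
      permute π (δ x y) △ x'         ≡⟨ cong (_△ x') πδ ⟩
      (x' △ label x' y') △ x'        ≡⟨ cong (_△ x') (△-comm x' (label x' y')) ⟩
      (label x' y' △ x') △ x'        ≡⟨ △-cancelʳ (label x' y') x' ⟩
      label x' y'                    ∎
      where open ≡-Reasoning

orbits : Odd n → (x y z x' y' z' : X n) → SameOrbit₃ x y z x' y' z' ⇔ (∂₃ x y z ≡ ∂₃ x' y' z')
orbits odd x y z x' y' z' = mk⇔ (same-orbit⇒same-∂ odd x y z x' y' z') (same-∂⇒same-orbit x y z x' y' z')

proposition3p10 : (D : ℕ) → 3 ≤ D →
    ((∀ (x y z : X (suc (D + D))) → InI' D (∂₃ x y z))
     × (∀ i j t → InI' D (i , j , t) →
          ∃ λ (x : X (suc (D + D))) → ∃ λ y → ∃ λ z → ∂₃ x y z ≡ (i , j , t))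
     × (∀ (x y z x' y' z' : X (suc (D + D))) →
          SameOrbit₃ x y z x' y' z' ⇔ (∂₃ x y z ≡ ∂₃ x' y' z')))
    × ((∀ (x y : X (suc (D + D))) → InI' D (∂₃ 𝟎 x y))
     × (∀ i j t → InI' D (i , j , t) →
          ∃ λ (x : X (suc (D + D))) → ∃ λ y → ∂₃ 𝟎 x y ≡ (i , j , t))
     × (∀ (x y x' y' : X (suc (D + D))) →
          SameOrbit₀ x y x' y' ⇔ (∂₃ 𝟎 x y ≡ ∂₃ 𝟎 x' y')))
proposition3p10 D _ =
  (∂₃∈I′ D , (λ i j t i∈I′ → 𝟎 , realise-from-𝟎 D i j t i∈I′) , orbits odd) ,
  (∂₃∈I′ D 𝟎 , realise-from-𝟎 D , λ x y x' y' → orbits odd 𝟎 x y 𝟎 x' y')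
  where
  odd : Odd (suc (D + D))
  odd = D , refl
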